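{- For every $n\ge 0$, $$G_{n+1}(x_1,x_2;y_1,y_2)=M_n(x_1y_1;\,x_2+y_2).$$
   Context: A plane tree is an unlabeled rooted tree in which the children of every vertex are linearly ordered from left to right; $\mathcal{P}_n$ is the set of plane trees with $n$ edges. A leaf is a vertex with no children, an interior vertex one with at least one child. A leaf is an old leaf if it is the leftmost child of its parent (including a leaf that is the only child), and a young leaf otherwise. For $T\in\mathcal P_n$, $\mathrm{oleaf}(T),\mathrm{yleaf}(T)$ are the numbers of old and young leaves, $\mathrm{oint}(T)$ the number of interior vertices that are parents of old leaves, $\mathrm{yint}(T)$ the number of interior vertices that are not parents of old leaves. For $n\ge1$, $G_n(x_1,x_2;y_1,y_2)=\sum_{T\in\mathcal P_n}x_1^{\mathrm{oleaf}(T)}x_2^{\mathrm{yleaf}(T)}y_1^{\mathrm{oint}(T)}y_2^{\mathrm{yint}(T)}$. The Motzkin polynomials are $M_n(u;v)=\sum_{k=0}^{\lfloor n/2\rfloor}\binom{n}{2k}C_k u^{k+1}v^{n-2k}$, where $C_k=\frac{1}{k+1}\binom{2k}{k}$ is the Catalan number. -}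

module Defs where

open import Level using (Level)
open import Data.Nat using (ℕ; zero; suc; _+_; _∸_; _*_; _/_)
open import Data.Nat.Combinatorics using (_C_)
open import Data.Bool using (Bool; true; false; if_then_else_)
open import Data.List using (List; []; _∷_; map; concatMap; upTo; foldr; length)
open import Algebra.Bundles using (CommutativeSemiring)
import Algebra.Definitions.RawSemiring as RS
import Data.Nat as N

data PlaneTree : Set where
  node : List PlaneTree → PlaneTree

Forest : Set
Forest = List PlaneTree

mutual
  edges : PlaneTree → ℕ
  edges (node cs) = edgesF cs

  edgesF : Forest → ℕ
  edgesF []       = 0
  edgesF (t ∷ ts) = suc (edges t) + edgesF ts

isLeaf : PlaneTree → Bool
isLeaf (node [])      = true
isLeaf (node (_ ∷ _)) = false

b2n : Bool → ℕ
b2n true  = 1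
b2n false = 0

not : Bool → Bool
not true  = false
not false = true

-- Enumeration of plane trees with n edges.
-- forestsF fuel n : all ordered forests whose total number of edges
-- (edges inside the trees plus one edge from the root to each tree)
-- equals n; correct as soon as fuel ≥ n.  A forest with n > 0 edges
-- is uniquely a first tree t with k ∸ 1 edges (k = 1..n, so the
-- first child contributes k edges) followed by a forest with n ∸ k edges.

forestsF : ℕ → ℕ → List Forest
forestsF zero    zero    = [] ∷ []
forestsF zero    (suc _) = []
forestsF (suc f) zero    = [] ∷ []
forestsF (suc f) (suc n) =
  concatMap (λ j →
    concatMap (λ cs →
      map (λ ts → node cs ∷ ts) (forestsF f (n ∸ j)))
      (forestsF f j))
    (upTo (suc n))

planeTrees : ℕ → List PlaneTree
planeTrees n = map node (forestsF n n)

-- Statistics.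
-- old leaf   : leaf that is the leftmost child of its parent
-- young leaf : leaf that is a non-leftmost child
-- oint       : interior vertices whose leftmost child is a leaf
--              (= parents of old leaves)
-- yint       : interior vertices whose leftmost child is not a leaf

mutual
  oleaf : PlaneTree → ℕ
  oleaf (node [])       = 0
  oleaf (node (c ∷ cs)) = b2n (isLeaf c) + oleafF (c ∷ cs)

  oleafF : Forest → ℕ
  oleafF []       = 0
  oleafF (t ∷ ts) = oleaf t + oleafF ts

mutual
  yleaf : PlaneTree → ℕ
  yleaf (node [])       = 0
  yleaf (node (c ∷ cs)) = leavesF cs + yleafF (c ∷ cs)

  yleafF : Forest → ℕ
  yleafF []       = 0
  yleafF (t ∷ ts) = yleaf t + yleafF ts

  leavesF : Forest → ℕ
  leavesF []       = 0
  leavesF (t ∷ ts) = b2n (isLeaf t) + leavesF ts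

mutual
  oint : PlaneTree → ℕ
  oint (node [])       = 0
  oint (node (c ∷ cs)) = b2n (isLeaf c) + ointF (c ∷ cs)

  ointF : Forest → ℕ
  ointF []       = 0
  ointF (t ∷ ts) = oint t + ointF ts

mutual
  yint : PlaneTree → ℕ
  yint (node [])       = 0
  yint (node (c ∷ cs)) = b2n (not (isLeaf c)) + yintF (c ∷ cs)

  yintF : Forest → ℕ
  yintF []       = 0
  yintF (t ∷ ts) = yint t + yintF ts

catalan : ℕ → ℕ
catalan k = ((2 * k) C k) / suc k

-- Polynomials G_n and M_n, evaluated in an arbitrary commutative
-- semiring (this is equivalent to an identity of polynomials with
-- natural-number coefficients, taking R = ℕ[x₁,x₂,y₁,y₂]).

module _ {c ℓ : Level} (R : CommutativeSemiring c ℓ) where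
  open CommutativeSemiring R using (Carrier; 0#; rawSemiring)
    renaming (_+_ to _⊕_; _*_ to _⊗_)
  open RS rawSemiring using (_^_; _×_)

  sumR : List Carrier → Carrier
  sumR = foldr _⊕_ 0#

  G : ℕ → Carrier → Carrier → Carrier → Carrier → Carrier
  G n x₁ x₂ y₁ y₂ = sumR (map (λ T →
      (((x₁ ^ oleaf T) ⊗ (x₂ ^ yleaf T)) ⊗ (y₁ ^ oint T)) ⊗ (y₂ ^ yint T))
    (planeTrees n))

  M : ℕ → Carrier → Carrier → Carrier
  M n u v = sumR (map (λ k →
      ((((n C (2 N.* k)) N.* catalan k) × (u ^ suc k)) ⊗ (v ^ (n ∸ 2 N.* k))))
    (upTo (suc (n / 2))))

{-# OPTIONS --safe #-}

-- A plane tree with n + 1 edges is a root over a nonempty forest, and the root's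
-- statistics are read off its children: a leaf as leftmost child is an old leaf and
-- makes the root an oint vertex (x₁y₁), any other leftmost child makes it a yint
-- vertex (y₂), and every later leaf child is a young leaf (x₂).  With
-- a(z) = Σ_{n≥1} Gₙ zⁿ and F(z) the series of forests weighted alike, this gives
--   a = z (x₁y₁ + y₂ a) F   and   F = 1 + z (x₂ + a) F,
-- hence the Motzkin equation a = z (u + v a + a²) with u = x₁y₁ and v = x₂ + y₂.
-- The coefficients of the powers of a obey the last-step recursion of Motzkin paths
-- (up-steps weighted u, level steps v): [z^{N+1}] a^{h+1} = u·P_h(N), where P_h(N)
-- weighs the paths of length N from height 0 to height h.  Choosing the 2k + h
-- non-level steps and one of the ballot k h admissible orders of k down- and k + h
-- up-steps gives P_h(N) = Σ_k C(N, 2k+h) · ballot k h · u^{k+h} v^{N-2k-h}, and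
-- ballot k 0 is the Catalan number by the reflection identity.

module Submission where

open import Defs
open import Level using (Level)
open import Data.Nat using (ℕ; suc)
open import Algebra.Bundles using (CommutativeSemiring)

open import Data.Nat as ℕ using (zero; _∸_; _≤_; _<_; z≤n; s≤s)
import Data.Nat.Properties as ℕₚ
open import Data.Nat.Properties using (≤-refl; ≤-trans; m∸n≤m; n≤1+n; m≤m+n; <-≤-trans; +-∸-assoc; ≰⇒>)
open import Relation.Nullary using (yes; no)
open import Data.List using (List; []; _∷_; _++_; map; concat; concatMap; applyUpTo; upTo)
open import Data.List.Properties using (map-cong-local; map-applyUpTo)
open import Data.List.Relation.Unary.All.Properties using (applyUpTo⁺₁)
open import Function using (_∘_)
open import Relation.Binary.PropositionalEquality as ≡ using (_≡_)

module Counting where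
  open import Data.Nat using (_+_; _*_; _/_)
  open import Data.Nat.Properties
  open import Data.Nat.Combinatorics using (_C_; nCk+nC[k+1]≡[n+1]C[k+1]; nC1≡n; nCk≡nC[n∸k]; k>n⇒nCk≡0)
  open import Data.Nat.DivMod using (m*n/n≡m; /-monoˡ-≤)
  open import Data.Nat.Tactic.RingSolver using (solve-∀)
  open import Relation.Binary.PropositionalEquality
    using (refl; sym; trans; cong; cong₂; module ≡-Reasoning)

  -- Paths of k down- and k + j up-steps from height 0 to height j that never go
  -- below 0, counted by their last step.
  ballot : ℕ → ℕ → ℕ
  ballot zero    j       = 1
  ballot (suc k) zero    = ballot k 1
  ballot (suc k) (suc j) = ballot (suc k) j + ballot k (suc (suc j))

  pascal : ∀ n k → suc n C suc k ≡ n C k + n C suc k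
  pascal n k = sym (nCk+nC[k+1]≡[n+1]C[k+1] n k)

  -- (k + 1) C(n, k + 1) = (n − k) C(n, k), without truncated subtraction.
  absorption : ∀ n k → suc k * (n C suc k) + k * (n C k) ≡ n * (n C k)
  absorption zero    zero    = refl
  absorption zero    (suc k) = cong₂ _+_ (vanish (suc k)) (vanish k)
    where
    vanish : ∀ m → suc m * (0 C suc m) ≡ 0
    vanish m = trans (cong (suc m *_) (k>n⇒nCk≡0 {0} {suc m} (s≤s z≤n))) (*-zeroʳ (suc m))
  absorption (suc n) zero    =
    trans (+-identityʳ _) (trans (*-identityˡ _) (trans (nC1≡n (suc n)) (sym (*-identityʳ _))))
  absorption (suc n) (suc k) = begin
    suc (suc k) * (suc n C suc (suc k)) + suc k * (suc n C suc k)
      ≡⟨ cong₂ (λ x y → suc (suc k) * x + suc k * y) (pascal n (suc k)) (pascal n k) ⟩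
    suc (suc k) * (b + c) + suc k * (a + b)
      ≡⟨ regroup k a b c ⟩
    (suc (suc k) * c + suc k * b) + b + (suc k * b + k * a) + a
      ≡⟨ cong₂ (λ x y → x + b + y + a) (absorption n (suc k)) (absorption n k) ⟩
    n * b + b + (n * a) + a
      ≡⟨ collect n a b ⟩
    suc n * (a + b)
      ≡⟨ cong (suc n *_) (pascal n k) ⟨
    suc n * (suc n C suc k) ∎
    where
    open ≡-Reasoning
    a = n C k
    b = n C suc k
    c = n C suc (suc k)
    regroup : ∀ k a b c → suc (suc k) * (b + c) + suc k * (a + b)
                        ≡ (suc (suc k) * c + suc k * b) + b + (suc k * b + k * a) + a
    regroup = solve-∀
    collect : ∀ n a b → n * b + b + n * a + a ≡ suc n * (a + b)
    collect = solve-∀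

  C-symmetric : ∀ {n} a b → n ≡ a + b → n C a ≡ n C b
  C-symmetric a b refl = trans (nCk≡nC[n∸k] (m≤m+n a b)) (cong ((a + b) C_) (m+n∸m≡n a b))

  -- ballot (k + 1) j = C(n + 2, k + 1) − C(n + 2, k) for n = 2k + j.  The length n
  -- comes with its defining equation so that the recursive calls need no rewriting.
  ballot-reflection : ∀ k j n → n ≡ k + k + j →
                      ballot (suc k) j + suc (suc n) C k ≡ suc (suc n) C suc k
  ballot-reflection zero    zero    n refl = refl
  ballot-reflection zero    (suc j) n refl = begin
    ballot 1 j + 1 + 1
      ≡⟨ cong (_+ 1) (ballot-reflection zero j j refl) ⟩
    suc (suc j) C 1 + 1
      ≡⟨ +-comm _ 1 ⟩
    1 + suc (suc j) C 1
      ≡⟨ pascal (suc (suc j)) 0 ⟨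
    suc (suc (suc j)) C 1 ∎
    where open ≡-Reasoning
  ballot-reflection (suc k) zero    _ refl = begin
    ballot (suc k) 1 + suc t C suc k
      ≡⟨ cong (ballot (suc k) 1 +_) (pascal t k) ⟩
    ballot (suc k) 1 + (t C k + t C suc k)
      ≡⟨ +-assoc (ballot (suc k) 1) _ _ ⟨
    ballot (suc k) 1 + t C k + t C suc k
      ≡⟨ cong (_+ t C suc k) (ballot-reflection k 1 m (shape k)) ⟩
    t C suc k + t C suc k
      ≡⟨ cong (t C suc k +_) (C-symmetric (suc k) (suc (suc k)) (middle k)) ⟩
    t C suc k + t C suc (suc k)
      ≡⟨ pascal t (suc k) ⟨
    suc t C suc (suc k) ∎
    where
    open ≡-Reasoning
    m = k + suc k + 0
    t = suc (suc m)
    shape : ∀ k → k + suc k + 0 ≡ k + k + 1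
    shape = solve-∀
    middle : ∀ k → suc (suc (k + suc k + 0)) ≡ suc k + suc (suc k)
    middle = solve-∀
  ballot-reflection (suc k) (suc j) _ refl = begin
    (b₁ + b₂) + suc t C suc k
      ≡⟨ cong (b₁ + b₂ +_) (pascal t k) ⟩
    (b₁ + b₂) + (t C k + t C suc k)
      ≡⟨ interchange b₁ b₂ (t C k) (t C suc k) ⟩
    (b₁ + t C suc k) + (b₂ + t C k)
      ≡⟨ cong₂ _+_ (ballot-reflection (suc k) j m (shape₁ k j))
                   (ballot-reflection k (suc (suc j)) m (shape₂ k j)) ⟩
    t C suc (suc k) + t C suc k
      ≡⟨ +-comm (t C suc (suc k)) _ ⟩
    t C suc k + t C suc (suc k)
      ≡⟨ pascal t (suc k) ⟨
    suc t C suc (suc k) ∎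
    where
    open ≡-Reasoning
    m = k + suc k + suc j
    t = suc (suc m)
    b₁ = ballot (suc (suc k)) j
    b₂ = ballot (suc k) (suc (suc j))
    interchange : ∀ a b c d → (a + b) + (c + d) ≡ (a + d) + (b + c)
    interchange = solve-∀
    shape₁ : ∀ k j → k + suc k + suc j ≡ suc k + suc k + j
    shape₁ = solve-∀
    shape₂ : ∀ k j → k + suc k + suc j ≡ k + k + suc (suc j)
    shape₂ = solve-∀

  catalan-numerator : ∀ k → suc k * ballot k 0 ≡ (2 * k) C k
  catalan-numerator zero    = refl
  catalan-numerator (suc k) = begin
    suc (suc k) * ballot (suc k) 0   ≡⟨ +-cancelʳ-≡ (suc (suc k) * p) _ _ cancelled ⟩
    N C suc k                        ≡⟨ cong (_C suc k) (double k) ⟩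
    (2 * suc k) C suc k              ∎
    where
    open ≡-Reasoning
    N = suc (suc (k + k + 0))
    b = ballot (suc k) 0
    p = N C k
    q = N C suc k
    double : ∀ k → suc (suc (k + k + 0)) ≡ 2 * suc k
    double = solve-∀
    split : ∀ k p → suc (suc (k + k + 0)) * p ≡ suc (suc k) * p + k * p
    split = solve-∀
    absorbed : suc k * q ≡ suc (suc k) * p
    absorbed = +-cancelʳ-≡ (k * p) _ _ (trans (absorption N k) (split k p))
    cancelled : suc (suc k) * b + suc (suc k) * p ≡ q + suc (suc k) * p
    cancelled = begin
      suc (suc k) * b + suc (suc k) * p   ≡⟨ *-distribˡ-+ (suc (suc k)) b p ⟨
      suc (suc k) * (b + p)               ≡⟨ cong (suc (suc k) *_) (ballot-reflection k 0 _ refl) ⟩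
      suc (suc k) * q                     ≡⟨ cong (q +_) absorbed ⟩
      q + suc (suc k) * p                 ∎

  catalan≡ballot : ∀ k → catalan k ≡ ballot k 0
  catalan≡ballot k = begin
    ((2 * k) C k) / suc k        ≡⟨ cong (_/ suc k) (catalan-numerator k) ⟨
    (suc k * ballot k 0) / suc k ≡⟨ cong (_/ suc k) (*-comm (suc k) (ballot k 0)) ⟩
    (ballot k 0 * suc k) / suc k ≡⟨ m*n/n≡m (ballot k 0) (suc k) ⟩
    ballot k 0                   ∎
    where open ≡-Reasoning

  n/2<k⇒n<k+k+0 : ∀ n k → n / 2 < k → n < k + k + 0
  n/2<k⇒n<k+k+0 n k half<k = ≰⇒> λ k+k≤n → <⇒≱ half<k (begin
    k                 ≡⟨ m*n/n≡m k 2 ⟨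
    (k * 2) / 2       ≡⟨ cong (_/ 2) (twice k) ⟩
    (k + k + 0) / 2   ≤⟨ /-monoˡ-≤ 2 k+k≤n ⟩
    n / 2             ∎)
    where
    open ≤-Reasoning
    twice : ∀ k → k * 2 ≡ k + k + 0
    twice = solve-∀

open Counting using (ballot; pascal; catalan≡ballot; n/2<k⇒n<k+k+0)

nonemptyForests : (ℕ → List Forest) → ℕ → List Forest
nonemptyForests E n =
  concatMap (λ j → concatMap (λ cs → map (node cs ∷_) (E (n ∸ j))) (E j)) (upTo (suc n))

nonemptyForests-cong : ∀ {E E′ : ℕ → List Forest} n →
  (∀ m → m ≤ n → E m ≡ E′ m) → nonemptyForests E n ≡ nonemptyForests E′ n
nonemptyForests-cong n E≡E′ =
  ≡.cong concat (map-cong-local (applyUpTo⁺₁ _ (suc n) λ {j} j<1+n →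
    ≡.cong₂ (λ first rest → concatMap (λ cs → map (node cs ∷_) rest) first)
            (E≡E′ j (ℕ.≤-pred j<1+n)) (E≡E′ (n ∸ j) (m∸n≤m n j))))

forestsF-fuel : ∀ f g n → n ≤ f → n ≤ g → forestsF f n ≡ forestsF g n
forestsF-fuel zero    zero    zero    _         _         = ≡.refl
forestsF-fuel zero    (suc g) zero    _         _         = ≡.refl
forestsF-fuel (suc f) zero    zero    _         _         = ≡.refl
forestsF-fuel (suc f) (suc g) zero    _         _         = ≡.refl
forestsF-fuel (suc f) (suc g) (suc n) (s≤s n≤f) (s≤s n≤g) =
  nonemptyForests-cong n λ m m≤n → forestsF-fuel f g m (≤-trans m≤n n≤f) (≤-trans m≤n n≤g)

forestsOf : ℕ → List Forest
forestsOf n = forestsF n n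

forestsOf-suc : ∀ n → forestsOf (suc n) ≡ nonemptyForests forestsOf n
forestsOf-suc n = nonemptyForests-cong n λ m m≤n → forestsF-fuel n m m m≤n ≤-refl

module _ {c ℓ : Level} (R : CommutativeSemiring c ℓ) where

  open CommutativeSemiring R renaming (Carrier to A)
  open import Algebra.Definitions.RawSemiring rawSemiring using (_^_; _×_)
  open import Algebra.Properties.Semiring.Mult semiring using (×-homo-+; ×1-homo-*; ×-assoc-*; ×-congʳ)
  open import Algebra.Properties.Semiring.Exp semiring using (^-homo-*)
  open import Algebra.Properties.CommutativeSemigroup +-commutativeSemigroup using (interchange)
  open import Algebra.Properties.CommutativeSemigroup *-commutativeSemigroup using (x∙yz≈y∙xz)
  open import Relation.Binary.Reasoning.Setoid setoid
  open import Algebra.Solver.Ring.NaturalCoefficients.Default R using (solve; _:+_; _:*_; _:=_; con)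
  open import Data.Nat.Combinatorics using (_C_; k>n⇒nCk≡0)
  open import Data.Nat.DivMod using (m/n≤m)
  open import Data.Nat.Tactic.RingSolver using (solve-∀)

  private
    variable
      X Y : Set

  ∑ : List X → (X → A) → A
  ∑ xs f = sumR R (map f xs)

  syntax ∑ xs (λ x → e) = ∑[ x ∈ xs ] e

  ∑-cong : (xs : List X) {f g : X → A} → (∀ x → f x ≈ g x) → ∑ xs f ≈ ∑ xs g
  ∑-cong []       f≈g = refl
  ∑-cong (x ∷ xs) f≈g = +-cong (f≈g x) (∑-cong xs f≈g)

  ∑-*ˡ : ∀ y (xs : List X) f → y * ∑ xs f ≈ ∑[ x ∈ xs ] (y * f x)
  ∑-*ˡ y []       f = zeroʳ y
  ∑-*ˡ y (x ∷ xs) f = trans (distribˡ y (f x) _) (+-cong refl (∑-*ˡ y xs f))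

  ∑-*ʳ : ∀ y (xs : List X) f → ∑ xs f * y ≈ ∑[ x ∈ xs ] (f x * y)
  ∑-*ʳ y []       f = zeroˡ y
  ∑-*ʳ y (x ∷ xs) f = trans (distribʳ y (f x) _) (+-cong refl (∑-*ʳ y xs f))

  ∑-++ : (xs ys : List X) (f : X → A) → ∑ (xs ++ ys) f ≈ ∑ xs f + ∑ ys f
  ∑-++ []       ys f = sym (+-identityˡ _)
  ∑-++ (x ∷ xs) ys f = trans (+-cong refl (∑-++ xs ys f)) (sym (+-assoc (f x) _ _))

  ∑-map : (g : X → Y) (xs : List X) (f : Y → A) → ∑ (map g xs) f ≈ ∑[ x ∈ xs ] f (g x)
  ∑-map g []       f = refl
  ∑-map g (x ∷ xs) f = +-cong refl (∑-map g xs f)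

  ∑-concatMap : (g : X → List Y) (xs : List X) (f : Y → A) →
                ∑ (concatMap g xs) f ≈ ∑[ x ∈ xs ] ∑ (g x) f
  ∑-concatMap g []       f = refl
  ∑-concatMap g (x ∷ xs) f = trans (∑-++ (g x) _ f) (+-cong refl (∑-concatMap g xs f))

  ∑< : ℕ → (ℕ → A) → A
  ∑< n f = sumR R (applyUpTo f n)

  syntax ∑< n (λ i → e) = ∑[ i < n ] e

  ∑<-cong : ∀ n {f g : ℕ → A} → (∀ i → f i ≈ g i) → ∑< n f ≈ ∑< n g
  ∑<-cong zero    f≈g = refl
  ∑<-cong (suc n) f≈g = +-cong (f≈g 0) (∑<-cong n (f≈g ∘ suc))

  ∑<-+ : ∀ n (f g : ℕ → A) → ∑[ i < n ] (f i + g i) ≈ ∑< n f + ∑< n g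
  ∑<-+ zero    f g = sym (+-identityˡ 0#)
  ∑<-+ (suc n) f g = trans (+-cong refl (∑<-+ n (f ∘ suc) (g ∘ suc))) (interchange (f 0) (g 0) _ _)

  ∑<-*ˡ : ∀ n x (f : ℕ → A) → x * ∑< n f ≈ ∑[ i < n ] (x * f i)
  ∑<-*ˡ zero    x f = zeroʳ x
  ∑<-*ˡ (suc n) x f = trans (distribˡ x (f 0) _) (+-cong refl (∑<-*ˡ n x (f ∘ suc)))

  ∑-upTo : ∀ n (f : ℕ → A) → ∑ (upTo n) f ≈ ∑< n f
  ∑-upTo n f = reflexive (≡.cong (sumR R) (map-applyUpTo (λ i → i) f n))

  ∑<-truncate : ∀ {m} n (f : ℕ → A) → m ≤ n → (∀ i → m ≤ i → f i ≈ 0#) → ∑< n f ≈ ∑< m f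
  ∑<-truncate zero    f z≤n       f≈0 = refl
  ∑<-truncate (suc n) f z≤n       f≈0 =
    trans (+-cong (f≈0 0 z≤n) (∑<-truncate n (f ∘ suc) z≤n λ i _ → f≈0 (suc i) z≤n))
          (+-identityˡ 0#)
  ∑<-truncate (suc n) f (s≤s m≤n) f≈0 =
    +-cong refl (∑<-truncate n (f ∘ suc) m≤n λ i m≤i → f≈0 (suc i) (s≤s m≤i))

  Series : Set c
  Series = ℕ → A

  infix 4 _≋_
  _≋_ : Series → Series → Set ℓ
  s ≋ t = ∀ n → s n ≈ t n

  -- δ is the series 1 and shift multiplies by z.
  δ : Series
  δ zero    = 1#
  δ (suc _) = 0#

  shift : Series → Series
  shift s zero    = 0#
  shift s (suc n) = s n

  shift-cong : ∀ {s t} → s ≋ t → shift s ≋ shift t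
  shift-cong s≋t zero    = refl
  shift-cong s≋t (suc n) = s≋t n

  -- (s ⋆ t) (suc n) unfolds definitionally to s 0 * t (suc n) + ((s ∘ suc) ⋆ t) n,
  -- which drives the inductions below.
  infixl 7 _⋆_
  _⋆_ : Series → Series → Series
  (s ⋆ t) n = ∑[ i < suc n ] (s i * t (n ∸ i))

  ⋆-cong : ∀ {s s′ t t′} → s ≋ s′ → t ≋ t′ → s ⋆ t ≋ s′ ⋆ t′
  ⋆-cong s≋s′ t≋t′ n = ∑<-cong (suc n) λ i → *-cong (s≋s′ i) (t≋t′ (n ∸ i))

  ⋆-distribʳ : ∀ s s′ t → (λ i → s i + s′ i) ⋆ t ≋ λ n → (s ⋆ t) n + (s′ ⋆ t) n
  ⋆-distribʳ s s′ t n =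
    trans (∑<-cong (suc n) λ i → distribʳ (t (n ∸ i)) (s i) (s′ i))
          (∑<-+ (suc n) (λ i → s i * t (n ∸ i)) (λ i → s′ i * t (n ∸ i)))

  ⋆-scaleˡ : ∀ x s t → (λ i → x * s i) ⋆ t ≋ λ n → x * (s ⋆ t) n
  ⋆-scaleˡ x s t n =
    trans (∑<-cong (suc n) λ i → *-assoc x (s i) (t (n ∸ i)))
          (sym (∑<-*ˡ (suc n) x λ i → s i * t (n ∸ i)))

  ⋆-identityˡ : ∀ t → δ ⋆ t ≋ t
  ⋆-identityˡ t n =
    trans (+-cong (*-identityˡ (t n)) (∑<-truncate n _ z≤n λ i _ → zeroˡ _)) (+-identityʳ (t n))

  ⋆-shiftˡ : ∀ s t → shift s ⋆ t ≋ shift (s ⋆ t)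
  ⋆-shiftˡ s t zero    = trans (+-identityʳ _) (zeroˡ (t 0))
  ⋆-shiftˡ s t (suc n) = trans (+-cong (zeroˡ _) refl) (+-identityˡ _)

  ⋆-sucʳ : ∀ s t n → (s ⋆ t) (suc n) ≈ (s ⋆ (t ∘ suc)) n + s (suc n) * t 0
  ⋆-sucʳ s t zero    = regroup (s 0 * t 1) (s 1 * t 0)
    where
    regroup : ∀ a b → a + (b + 0#) ≈ (a + 0#) + b
    regroup = solve 2 (λ a b → a :+ (b :+ con 0) := (a :+ con 0) :+ b) refl
  ⋆-sucʳ s t (suc n) =
    trans (+-cong refl (⋆-sucʳ (s ∘ suc) t n)) (sym (+-assoc (s 0 * t (suc (suc n))) _ _))

  ⋆-comm : ∀ s t → s ⋆ t ≋ t ⋆ s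
  ⋆-comm s t zero    = +-cong (*-comm (s 0) (t 0)) refl
  ⋆-comm s t (suc n) = begin
    s 0 * t (suc n) + ((s ∘ suc) ⋆ t) n   ≈⟨ +-comm _ _ ⟩
    ((s ∘ suc) ⋆ t) n + s 0 * t (suc n)   ≈⟨ +-cong (⋆-comm (s ∘ suc) t n) (*-comm (s 0) (t (suc n))) ⟩
    (t ⋆ (s ∘ suc)) n + t (suc n) * s 0   ≈⟨ ⋆-sucʳ t s n ⟨
    (t ⋆ s) (suc n)                       ∎

  ⋆-assoc : ∀ s t w → (s ⋆ t) ⋆ w ≋ s ⋆ (t ⋆ w)
  ⋆-assoc s t w zero    = regroup (s 0) (t 0) (w 0)
    where
    regroup : ∀ a b c → (a * b + 0#) * c + 0# ≈ a * (b * c + 0#) + 0#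
    regroup = solve 3 (λ a b c → (a :* b :+ con 0) :* c :+ con 0
                              := a :* (b :* c :+ con 0) :+ con 0) refl
  ⋆-assoc s t w (suc n) = begin
    (s ⋆ t) 0 * w (suc n) + ((λ i → s 0 * t (suc i) + ((s ∘ suc) ⋆ t) i) ⋆ w) n
      ≈⟨ +-cong refl (⋆-distribʳ (λ i → s 0 * t (suc i)) ((s ∘ suc) ⋆ t) w n) ⟩
    (s ⋆ t) 0 * w (suc n) + (((λ i → s 0 * t (suc i)) ⋆ w) n + (((s ∘ suc) ⋆ t) ⋆ w) n)
      ≈⟨ +-cong refl (+-cong (⋆-scaleˡ (s 0) (t ∘ suc) w n) (⋆-assoc (s ∘ suc) t w n)) ⟩
    (s 0 * t 0 + 0#) * w (suc n) + (s 0 * ((t ∘ suc) ⋆ w) n + ((s ∘ suc) ⋆ (t ⋆ w)) n)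
      ≈⟨ regroup (s 0) (t 0) (w (suc n)) _ _ ⟩
    s 0 * (t 0 * w (suc n) + ((t ∘ suc) ⋆ w) n) + ((s ∘ suc) ⋆ (t ⋆ w)) n
      ∎
    where
    regroup : ∀ a b c d e → (a * b + 0#) * c + (a * d + e) ≈ a * (b * c + d) + e
    regroup = solve 5 (λ a b c d e → (a :* b :+ con 0) :* c :+ (a :* d :+ e)
                                  := a :* (b :* c :+ d) :+ e) refl

  xy⋆z≋zy⋆x : ∀ s t w → (s ⋆ t) ⋆ w ≋ (w ⋆ t) ⋆ s
  xy⋆z≋zy⋆x s t w n =
    trans (⋆-assoc s t w n) (trans (⋆-comm s (t ⋆ w) n) (⋆-cong {t = s} (⋆-comm t w) (λ _ → refl) n))

  infixr 8 _^⋆_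
  _^⋆_ : Series → ℕ → Series
  s ^⋆ zero  = δ
  s ^⋆ suc h = (s ^⋆ h) ⋆ s

  ι : ℕ → A
  ι n = n × 1#

  ×≈ι* : ∀ n x → n × x ≈ ι n * x
  ×≈ι* n x = sym (trans (×-assoc-* n 1# x) (×-congʳ n (*-identityˡ x)))

  ι-C-vanish : ∀ {N e} → N < e → ∀ w x → ι (N C e) * w * x ≈ 0#
  ι-C-vanish N<e w x =
    trans (*-cong (trans (*-cong (reflexive (≡.cong ι (k>n⇒nCk≡0 N<e))) refl) (zeroˡ w)) refl)
          (zeroˡ x)

  module MotzkinPaths (u v : A) where

    -- e of the N steps are non-level and weigh w together; the others are level steps.
    binomTerm : ℕ → ℕ → A → A
    binomTerm N e w = ι (N C e) * w * v ^ (N ∸ e)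

    binomTerm-congʳ : ∀ N e {w w′} → w ≈ w′ → binomTerm N e w ≈ binomTerm N e w′
    binomTerm-congʳ N e w≈w′ = *-cong (*-cong refl w≈w′) refl

    binomTerm-*ˡ : ∀ N e x w → binomTerm N e (x * w) ≈ x * binomTerm N e w
    binomTerm-*ˡ N e x w =
      solve 4 (λ i x w V → i :* (x :* w) :* V := x :* (i :* w :* V)) refl (ι (N C e)) x w _

    binomTerm-+ : ∀ N e w w′ → binomTerm N e (w + w′) ≈ binomTerm N e w + binomTerm N e w′
    binomTerm-+ N e w w′ =
      solve 4 (λ i w w′ V → i :* (w :+ w′) :* V := i :* w :* V :+ i :* w′ :* V) refl (ι (N C e)) w w′ _

    binomTerm-suc-zero : ∀ N w → binomTerm (suc N) 0 w ≈ v * binomTerm N 0 w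
    binomTerm-suc-zero N w =
      solve 4 (λ i w v V → i :* w :* (v :* V) := v :* (i :* w :* V)) refl (ι 1) w v (v ^ N)

    binomTerm-suc-suc : ∀ N e w →
                        binomTerm (suc N) (suc e) w ≈ v * binomTerm N (suc e) w + binomTerm N e w
    binomTerm-suc-suc N e w = begin
      ι (suc N C suc e) * w * v ^ (N ∸ e)
        ≈⟨ *-cong (*-cong (trans (reflexive (≡.cong ι (pascal N e))) (×-homo-+ 1# (N C e) _)) refl)
                  refl ⟩
      (ι (N C e) + ι (N C suc e)) * w * v ^ (N ∸ e)
        ≈⟨ solve 4 (λ a b w V → (a :+ b) :* w :* V := b :* w :* V :+ a :* w :* V)
                   refl (ι (N C e)) (ι (N C suc e)) w _ ⟩
      ι (N C suc e) * w * v ^ (N ∸ e) + binomTerm N e w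
        ≈⟨ +-cong levelStep refl ⟩
      v * binomTerm N (suc e) w + binomTerm N e w ∎
      where
      -- When N ≤ e the exponent N ∸ e is truncated, but then N C suc e = 0.
      levelStep : ι (N C suc e) * w * v ^ (N ∸ e) ≈ v * binomTerm N (suc e) w
      levelStep with suc e ℕ.≤? N
      ... | yes e<N = begin
        ι (N C suc e) * w * v ^ (N ∸ e)
          ≡⟨ ≡.cong (λ p → ι (N C suc e) * w * v ^ p) (+-∸-assoc 1 e<N) ⟩
        ι (N C suc e) * w * (v * v ^ (N ∸ suc e))
          ≈⟨ solve 4 (λ i w v V → i :* w :* (v :* V) := v :* (i :* w :* V)) refl _ w v _ ⟩
        v * binomTerm N (suc e) w ∎
      ... | no e≮N = trans (ι-C-vanish (≰⇒> e≮N) w _)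
                           (sym (trans (*-cong refl (ι-C-vanish (≰⇒> e≮N) w _)) (zeroʳ v)))

    -- paths j N weighs the Motzkin paths of length N from height 0 to height j;
    -- pathTerm j N k collects those with k down-steps.
    pathTerm : ℕ → ℕ → ℕ → A
    pathTerm j N k = binomTerm N (k ℕ.+ k ℕ.+ j) (ι (ballot k j) * u ^ (k ℕ.+ j))

    paths : ℕ → ℕ → A
    paths j N = ∑[ k < suc N ] pathTerm j N k

    viaUp : ℕ → ℕ → ℕ → A
    viaUp zero    N k = 0#
    viaUp (suc j) N k = u * pathTerm j N k

    viaDown : ℕ → ℕ → ℕ → A
    viaDown j N zero    = 0#
    viaDown j N (suc k) = pathTerm (suc j) N k

    private
      reindex : ∀ N b {e e′ p p′} → e ≡ e′ → p ≡ p′ →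
                binomTerm N e (ι b * u ^ p) ≈ binomTerm N e′ (ι b * u ^ p′)
      reindex N b e≡e′ p≡p′ = reflexive (≡.cong₂ (λ e p → binomTerm N e (ι b * u ^ p)) e≡e′ p≡p′)

      upStep : ∀ N e b p → binomTerm N e (ι b * u ^ suc p) ≈ u * binomTerm N e (ι b * u ^ p)
      upStep N e b p = trans (binomTerm-congʳ N e (x∙yz≈y∙xz (ι b) u _)) (binomTerm-*ˡ N e u _)

    -- The last step is level, up from height j − 1, or down from height j + 1.
    pathTerm-suc : ∀ j N k → pathTerm j (suc N) k ≈ v * pathTerm j N k + viaUp j N k + viaDown j N k
    pathTerm-suc zero    N zero    =
      trans (binomTerm-suc-zero N _) (sym (trans (+-identityʳ _) (+-identityʳ _)))
    pathTerm-suc (suc j) N zero    = begin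
      binomTerm (suc N) (suc j) (ι 1 * u ^ suc j)
        ≈⟨ binomTerm-suc-suc N j _ ⟩
      v * pathTerm (suc j) N 0 + binomTerm N j (ι 1 * u ^ suc j)
        ≈⟨ +-cong refl (upStep N j 1 j) ⟩
      v * pathTerm (suc j) N 0 + u * pathTerm j N 0
        ≈⟨ +-identityʳ _ ⟨
      v * pathTerm (suc j) N 0 + u * pathTerm j N 0 + 0# ∎
    pathTerm-suc zero    N (suc k) = begin
      binomTerm (suc N) (suc (k ℕ.+ suc k ℕ.+ 0)) (ι (ballot k 1) * u ^ (suc k ℕ.+ 0))
        ≈⟨ binomTerm-suc-suc N _ _ ⟩
      v * pathTerm 0 N (suc k) + binomTerm N (k ℕ.+ suc k ℕ.+ 0) (ι (ballot k 1) * u ^ (suc k ℕ.+ 0))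
        ≈⟨ +-cong (+-identityʳ _) (sym (reindex N (ballot k 1) (index k) (exponent k))) ⟨
      v * pathTerm 0 N (suc k) + 0# + pathTerm 1 N k ∎
      where
      index : ∀ k → k ℕ.+ suc k ℕ.+ 0 ≡ k ℕ.+ k ℕ.+ 1
      index = solve-∀
      exponent : ∀ k → suc k ℕ.+ 0 ≡ k ℕ.+ 1
      exponent = solve-∀
    pathTerm-suc (suc j) N (suc k) = begin
      binomTerm (suc N) (suc e) (ι (b₁ ℕ.+ b₂) * u ^ (suc k ℕ.+ suc j))
        ≈⟨ binomTerm-suc-suc N e _ ⟩
      v * pathTerm (suc j) N (suc k) + binomTerm N e (ι (b₁ ℕ.+ b₂) * u ^ (suc k ℕ.+ suc j))
        ≈⟨ +-cong refl (binomTerm-congʳ N e (*-cong (×-homo-+ 1# b₁ b₂) refl)) ⟩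
      v * pathTerm (suc j) N (suc k) + binomTerm N e ((ι b₁ + ι b₂) * u ^ (suc k ℕ.+ suc j))
        ≈⟨ +-cong refl (trans (binomTerm-congʳ N e (distribʳ _ (ι b₁) (ι b₂))) (binomTerm-+ N e _ _)) ⟩
      v * pathTerm (suc j) N (suc k) + (binomTerm N e (ι b₁ * u ^ (suc k ℕ.+ suc j))
                                       + binomTerm N e (ι b₂ * u ^ (suc k ℕ.+ suc j)))
        ≈⟨ +-cong refl (+-cong (trans (reindex N b₁ (index₁ k j) (exponent₁ k j))
                                      (upStep N (suc k ℕ.+ suc k ℕ.+ j) b₁ (suc k ℕ.+ j)))
                               (reindex N b₂ (index₂ k j) (exponent₂ k j))) ⟩
      v * pathTerm (suc j) N (suc k) + (u * pathTerm j N (suc k) + pathTerm (suc (suc j)) N k)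
        ≈⟨ +-assoc _ _ _ ⟨
      v * pathTerm (suc j) N (suc k) + u * pathTerm j N (suc k) + pathTerm (suc (suc j)) N k ∎
      where
      e = k ℕ.+ suc k ℕ.+ suc j
      b₁ = ballot (suc k) j
      b₂ = ballot k (suc (suc j))
      index₁ : ∀ k j → k ℕ.+ suc k ℕ.+ suc j ≡ suc k ℕ.+ suc k ℕ.+ j
      index₁ = solve-∀
      exponent₁ : ∀ k j → suc k ℕ.+ suc j ≡ suc (suc k ℕ.+ j)
      exponent₁ = solve-∀
      index₂ : ∀ k j → k ℕ.+ suc k ℕ.+ suc j ≡ k ℕ.+ k ℕ.+ suc (suc j)
      index₂ = solve-∀
      exponent₂ : ∀ k j → suc k ℕ.+ suc j ≡ k ℕ.+ suc (suc j)
      exponent₂ = solve-∀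

    pathTerm-vanish : ∀ j N k → N < k → pathTerm j N k ≈ 0#
    pathTerm-vanish j N k N<k =
      ι-C-vanish (<-≤-trans N<k (≤-trans (m≤m+n k k) (m≤m+n (k ℕ.+ k) j))) _ _

    paths-extend : ∀ j N → ∑[ k < suc (suc N) ] pathTerm j N k ≈ paths j N
    paths-extend j N = ∑<-truncate (suc (suc N)) (pathTerm j N) (n≤1+n _) (pathTerm-vanish j N)

    paths-zero : ∀ j → paths j 0 ≈ δ j
    paths-zero zero    = trans (+-identityʳ _) (trans (*-identityʳ _)
      (trans (*-cong ι-1 (trans (*-identityʳ _) ι-1)) (*-identityˡ 1#)))
      where
      ι-1 : ι 1 ≈ 1#
      ι-1 = +-identityʳ 1#
    paths-zero (suc j) = trans (+-identityʳ _) (ι-C-vanish (s≤s (z≤n {j})) _ _)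

    endingInUp : ℕ → ℕ → A
    endingInUp zero    N = 0#
    endingInUp (suc j) N = u * paths j N

    ∑-viaUp : ∀ j N → ∑< (suc (suc N)) (viaUp j N) ≈ endingInUp j N
    ∑-viaUp zero    N = ∑<-truncate (suc (suc N)) (viaUp 0 N) z≤n λ _ _ → refl
    ∑-viaUp (suc j) N =
      trans (sym (∑<-*ˡ (suc (suc N)) u (pathTerm j N))) (*-cong refl (paths-extend j N))

    paths-suc : ∀ j N → paths j (suc N) ≈ v * paths j N + endingInUp j N + paths (suc j) N
    paths-suc j N = begin
      ∑[ k < suc (suc N) ] pathTerm j (suc N) k
        ≈⟨ ∑<-cong (suc (suc N)) (pathTerm-suc j N) ⟩
      ∑[ k < suc (suc N) ] (v * pathTerm j N k + viaUp j N k + viaDown j N k)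
        ≈⟨ trans (∑<-+ (suc (suc N)) (λ k → v * pathTerm j N k + viaUp j N k) (viaDown j N))
                 (+-cong (∑<-+ (suc (suc N)) (λ k → v * pathTerm j N k) (viaUp j N)) refl) ⟩
      ∑[ k < suc (suc N) ] (v * pathTerm j N k) + ∑< (suc (suc N)) (viaUp j N)
                                                + ∑< (suc (suc N)) (viaDown j N)
        ≈⟨ +-cong (+-cong levels (∑-viaUp j N)) (+-identityˡ _) ⟩
      v * paths j N + endingInUp j N + paths (suc j) N ∎
      where
      levels : ∑[ k < suc (suc N) ] (v * pathTerm j N k) ≈ v * paths j N
      levels = trans (sym (∑<-*ˡ (suc (suc N)) v (pathTerm j N))) (*-cong refl (paths-extend j N))

    u*paths≈M : ∀ n → u * paths 0 n ≈ M R n u v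
    u*paths≈M n = begin
      u * paths 0 n
        ≈⟨ ∑<-*ˡ (suc n) u (pathTerm 0 n) ⟩
      ∑[ k < suc n ] (u * pathTerm 0 n k)
        ≈⟨ ∑<-truncate (suc n) (λ k → u * pathTerm 0 n k) (s≤s (m/n≤m n 2)) beyondHalf ⟩
      ∑[ k < suc (n ℕ./ 2) ] (u * pathTerm 0 n k)
        ≈⟨ ∑<-cong (suc (n ℕ./ 2)) summand ⟩
      ∑[ k < suc (n ℕ./ 2) ] (((n C (2 ℕ.* k)) ℕ.* catalan k) × u ^ suc k * v ^ (n ∸ 2 ℕ.* k))
        ≈⟨ ∑-upTo (suc (n ℕ./ 2)) _ ⟨
      M R n u v ∎
      where
      beyondHalf : ∀ k → suc (n ℕ./ 2) ≤ k → u * pathTerm 0 n k ≈ 0#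
      beyondHalf k half<k = trans (*-cong refl (ι-C-vanish (n/2<k⇒n<k+k+0 n k half<k) _ _)) (zeroʳ u)
      summand : ∀ k → u * pathTerm 0 n k ≈
                      ((n C (2 ℕ.* k)) ℕ.* catalan k) × u ^ suc k * v ^ (n ∸ 2 ℕ.* k)
      summand k = begin
        u * (ι (n C (k ℕ.+ k ℕ.+ 0)) * (ι (ballot k 0) * u ^ (k ℕ.+ 0)) * v ^ (n ∸ (k ℕ.+ k ℕ.+ 0)))
          ≡⟨ ≡.cong₂ (λ e b → u * (ι (n C e) * (ι b * u ^ (k ℕ.+ 0)) * v ^ (n ∸ e)))
                     (twice k) (≡.sym (catalan≡ballot k)) ⟩
        u * (ι (n C (2 ℕ.* k)) * (ι (catalan k) * u ^ (k ℕ.+ 0)) * v ^ (n ∸ 2 ℕ.* k))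
          ≡⟨ ≡.cong (λ p → u * (ι (n C (2 ℕ.* k)) * (ι (catalan k) * u ^ p) * v ^ (n ∸ 2 ℕ.* k)))
                    (ℕₚ.+-identityʳ k) ⟩
        u * (ι (n C (2 ℕ.* k)) * (ι (catalan k) * u ^ k) * v ^ (n ∸ 2 ℕ.* k))
          ≈⟨ solve 5 (λ u a b U V → u :* (a :* (b :* U) :* V) := a :* b :* (u :* U) :* V)
                     refl u _ _ (u ^ k) _ ⟩
        ι (n C (2 ℕ.* k)) * ι (catalan k) * (u * u ^ k) * v ^ (n ∸ 2 ℕ.* k)
          ≈⟨ *-cong (trans (*-cong (sym (×1-homo-* (n C (2 ℕ.* k)) (catalan k))) refl)
                           (sym (×≈ι* ((n C (2 ℕ.* k)) ℕ.* catalan k) (u ^ suc k)))) refl ⟩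
        ((n C (2 ℕ.* k)) ℕ.* catalan k) × u ^ suc k * v ^ (n ∸ 2 ℕ.* k) ∎
        where
        twice : ∀ k → k ℕ.+ k ℕ.+ 0 ≡ 2 ℕ.* k
        twice = solve-∀

  module _ (u v : A) (a : Series) (a-zero : a 0 ≈ 0#)
           (a-suc : ∀ n → a (suc n) ≈ u * δ n + v * a n + (a ⋆ a) n) where

    open MotzkinPaths u v

    ^⋆-zero : ∀ h → (a ^⋆ h) 0 ≈ δ h
    ^⋆-zero zero    = refl
    ^⋆-zero (suc h) = trans (+-identityʳ _) (trans (*-cong refl a-zero) (zeroʳ _))

    ^⋆-suc : ∀ h n → (a ^⋆ suc h) (suc n) ≈
                     u * (a ^⋆ h) n + v * (a ^⋆ suc h) n + (a ^⋆ suc (suc h)) n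
    ^⋆-suc h n = begin
      (p ⋆ a) (suc n)
        ≈⟨ ⋆-comm p a (suc n) ⟩
      a 0 * p (suc n) + ((a ∘ suc) ⋆ p) n
        ≈⟨ +-cong (trans (*-cong a-zero refl) (zeroˡ _)) (⋆-cong {t = p} a-suc (λ _ → refl) n) ⟩
      0# + ((λ i → u * δ i + v * a i + (a ⋆ a) i) ⋆ p) n
        ≈⟨ +-identityˡ _ ⟩
      ((λ i → u * δ i + v * a i + (a ⋆ a) i) ⋆ p) n
        ≈⟨ trans (⋆-distribʳ (λ i → u * δ i + v * a i) (a ⋆ a) p n)
                 (+-cong (⋆-distribʳ (λ i → u * δ i) (λ i → v * a i) p n) refl) ⟩
      ((λ i → u * δ i) ⋆ p) n + ((λ i → v * a i) ⋆ p) n + ((a ⋆ a) ⋆ p) n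
        ≈⟨ +-cong (+-cong (⋆-scaleˡ u δ p n) (⋆-scaleˡ v a p n)) refl ⟩
      u * (δ ⋆ p) n + v * (a ⋆ p) n + ((a ⋆ a) ⋆ p) n
        ≈⟨ +-cong (+-cong (*-cong refl (⋆-identityˡ p n)) (*-cong refl (⋆-comm a p n)))
                  (trans (⋆-comm (a ⋆ a) p n) (sym (⋆-assoc p a a n))) ⟩
      u * p n + v * (p ⋆ a) n + ((p ⋆ a) ⋆ a) n ∎
      where
      p = a ^⋆ h

    ^⋆≈endingInUp : ∀ N h → (a ^⋆ h) (suc N) ≈ endingInUp h N
    ^⋆≈endingInUp N       zero    = refl
    ^⋆≈endingInUp zero    (suc h) = begin
      (a ^⋆ suc h) 1
        ≈⟨ ^⋆-suc h 0 ⟩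
      u * (a ^⋆ h) 0 + v * (a ^⋆ suc h) 0 + (a ^⋆ suc (suc h)) 0
        ≈⟨ +-cong (+-cong (*-cong refl (^⋆-zero h)) (*-cong refl (^⋆-zero (suc h))))
                  (^⋆-zero (suc (suc h))) ⟩
      u * δ h + v * 0# + 0#
        ≈⟨ solve 2 (λ x v → x :+ v :* con 0 :+ con 0 := x) refl (u * δ h) v ⟩
      u * δ h
        ≈⟨ *-cong refl (paths-zero h) ⟨
      u * paths h 0 ∎
    ^⋆≈endingInUp (suc N) (suc h) = begin
      (a ^⋆ suc h) (suc (suc N))
        ≈⟨ ^⋆-suc h (suc N) ⟩
      u * (a ^⋆ h) (suc N) + v * (a ^⋆ suc h) (suc N) + (a ^⋆ suc (suc h)) (suc N)
        ≈⟨ +-cong (+-cong (*-cong refl (^⋆≈endingInUp N h)) (*-cong refl (^⋆≈endingInUp N (suc h))))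
                  (^⋆≈endingInUp N (suc (suc h))) ⟩
      u * endingInUp h N + v * (u * paths h N) + u * paths (suc h) N
        ≈⟨ solve 5 (λ u v e p q → u :* e :+ v :* (u :* p) :+ u :* q := u :* (v :* p :+ e :+ q))
                   refl u v _ _ _ ⟩
      u * (v * paths h N + endingInUp h N + paths (suc h) N)
        ≈⟨ *-cong refl (paths-suc h N) ⟨
      u * paths h (suc N) ∎

    motzkinRecurrence⇒M : ∀ n → a (suc n) ≈ M R n u v
    motzkinRecurrence⇒M n = begin
      a (suc n)          ≈⟨ ⋆-identityˡ a (suc n) ⟨
      (a ^⋆ 1) (suc n)   ≈⟨ ^⋆≈endingInUp n 1 ⟩
      u * paths 0 n      ≈⟨ u*paths≈M n ⟩
      M R n u v          ∎

  ∑-nonemptyForests : ∀ E n (φ : Forest → A) → ∑ (nonemptyForests E n) φ ≈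
                      ∑[ j ∈ upTo (suc n) ] ∑[ cs ∈ E j ] ∑[ ts ∈ E (n ∸ j) ] φ (node cs ∷ ts)
  ∑-nonemptyForests E n φ =
    trans (∑-concatMap (λ j → concatMap (λ cs → map (node cs ∷_) (E (n ∸ j))) (E j)) (upTo (suc n)) φ)
          (∑-cong (upTo (suc n)) λ j →
    trans (∑-concatMap (λ cs → map (node cs ∷_) (E (n ∸ j))) (E j) φ)
          (∑-cong (E j) λ cs → ∑-map (node cs ∷_) (E (n ∸ j)) φ))

  ∑-forestsOf-suc : ∀ n (φ : Forest → A) →
                    ∑ (forestsOf (suc n)) φ ≈
                    ∑[ j ∈ upTo (suc n) ] ∑[ cs ∈ forestsOf j ]
                      ∑[ ts ∈ forestsOf (n ∸ j) ] φ (node cs ∷ ts)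
  ∑-forestsOf-suc n φ =
    trans (reflexive (≡.cong (λ fs → ∑ fs φ) (forestsOf-suc n))) (∑-nonemptyForests forestsOf n φ)

  ∑-forestsOf-suc-cong : ∀ n {φ ψ : Forest → A} → (∀ t ts → φ (t ∷ ts) ≈ ψ (t ∷ ts)) →
                         ∑ (forestsOf (suc n)) φ ≈ ∑ (forestsOf (suc n)) ψ
  ∑-forestsOf-suc-cong n {φ} {ψ} φ≈ψ =
    trans (∑-forestsOf-suc n φ) (trans (∑-cong (upTo (suc n)) λ j → ∑-cong (forestsOf j) λ cs →
      ∑-cong (forestsOf (n ∸ j)) λ ts → φ≈ψ (node cs) ts) (sym (∑-forestsOf-suc n ψ)))

  ∑-forestsOf-suc-⋆ : ∀ n (φ ω ρ : Forest → A) → (∀ cs ts → φ (node cs ∷ ts) ≈ ω cs * ρ ts) →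
                      ∑ (forestsOf (suc n)) φ ≈
                      ((λ j → ∑ (forestsOf j) ω) ⋆ (λ m → ∑ (forestsOf m) ρ)) n
  ∑-forestsOf-suc-⋆ n φ ω ρ φ≈ωρ = begin
    ∑ (forestsOf (suc n)) φ
      ≈⟨ ∑-forestsOf-suc n φ ⟩
    ∑[ j ∈ upTo (suc n) ] ∑[ cs ∈ forestsOf j ] ∑[ ts ∈ forestsOf (n ∸ j) ] φ (node cs ∷ ts)
      ≈⟨ ∑-cong (upTo (suc n)) factor ⟩
    ∑[ j ∈ upTo (suc n) ] (∑ (forestsOf j) ω * ∑ (forestsOf (n ∸ j)) ρ)
      ≈⟨ ∑-upTo (suc n) _ ⟩
    ((λ j → ∑ (forestsOf j) ω) ⋆ (λ m → ∑ (forestsOf m) ρ)) n ∎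
    where
    factor : ∀ j → ∑[ cs ∈ forestsOf j ] ∑[ ts ∈ forestsOf (n ∸ j) ] φ (node cs ∷ ts)
                   ≈ ∑ (forestsOf j) ω * ∑ (forestsOf (n ∸ j)) ρ
    factor j = begin
      ∑[ cs ∈ forestsOf j ] ∑[ ts ∈ forestsOf (n ∸ j) ] φ (node cs ∷ ts)
        ≈⟨ ∑-cong (forestsOf j) (λ cs → trans (∑-cong (forestsOf (n ∸ j)) (φ≈ωρ cs))
                                              (sym (∑-*ˡ (ω cs) (forestsOf (n ∸ j)) ρ))) ⟩
      ∑[ cs ∈ forestsOf j ] (ω cs * ∑ (forestsOf (n ∸ j)) ρ)
        ≈⟨ ∑-*ʳ _ (forestsOf j) ω ⟨
      ∑ (forestsOf j) ω * ∑ (forestsOf (n ∸ j)) ρ ∎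

  module PlaneTreeWeights (x₁ x₂ y₁ y₂ : A) where

    monomial : ℕ → ℕ → ℕ → ℕ → A
    monomial a b p q = x₁ ^ a * x₂ ^ b * y₁ ^ p * y₂ ^ q

    monomial-+ : ∀ a b p q a′ b′ p′ q′ → monomial (a ℕ.+ a′) (b ℕ.+ b′) (p ℕ.+ p′) (q ℕ.+ q′) ≈
                                         monomial a b p q * monomial a′ b′ p′ q′
    monomial-+ a b p q a′ b′ p′ q′ = begin
      monomial (a ℕ.+ a′) (b ℕ.+ b′) (p ℕ.+ p′) (q ℕ.+ q′)
        ≈⟨ *-cong (*-cong (*-cong (^-homo-* x₁ a a′) (^-homo-* x₂ b b′)) (^-homo-* y₁ p p′))
                  (^-homo-* y₂ q q′) ⟩
      x₁ ^ a * x₁ ^ a′ * (x₂ ^ b * x₂ ^ b′) * (y₁ ^ p * y₁ ^ p′) * (y₂ ^ q * y₂ ^ q′)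
        ≈⟨ solve 8 (λ A A′ B B′ P P′ Q Q′ → A :* A′ :* (B :* B′) :* (P :* P′) :* (Q :* Q′)
                                          := A :* B :* P :* Q :* (A′ :* B′ :* P′ :* Q′))
                   refl (x₁ ^ a) (x₁ ^ a′) (x₂ ^ b) (x₂ ^ b′) (y₁ ^ p) (y₁ ^ p′) (y₂ ^ q) (y₂ ^ q′) ⟩
      monomial a b p q * monomial a′ b′ p′ q′ ∎

    weight : PlaneTree → A
    weight T = monomial (oleaf T) (yleaf T) (oint T) (yint T)

    firstChildFactor : PlaneTree → A
    firstChildFactor (node [])      = x₁ * y₁
    firstChildFactor (node (_ ∷ _)) = y₂

    laterChildFactor : PlaneTree → A
    laterChildFactor (node [])      = x₂
    laterChildFactor (node (_ ∷ _)) = 1#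

    forestWeight : Forest → A
    forestWeight cs = monomial (oleafF cs) (leavesF cs ℕ.+ yleafF cs) (ointF cs) (yintF cs)

    firstChildFactor-monomial : ∀ t → monomial (b2n (isLeaf t)) 0 (b2n (isLeaf t)) (b2n (not (isLeaf t)))
                                      ≈ firstChildFactor t
    firstChildFactor-monomial (node [])      =
      solve 2 (λ x y → x :* con 1 :* con 1 :* (y :* con 1) :* con 1 := x :* y) refl x₁ y₁
    firstChildFactor-monomial (node (_ ∷ _)) =
      solve 1 (λ y → con 1 :* con 1 :* con 1 :* (y :* con 1) := y) refl y₂

    laterChildFactor-monomial : ∀ t → monomial 0 (b2n (isLeaf t)) 0 0 ≈ laterChildFactor t
    laterChildFactor-monomial (node [])      =
      solve 1 (λ x → con 1 :* (x :* con 1) :* con 1 :* con 1 := x) refl x₂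
    laterChildFactor-monomial (node (_ ∷ _)) =
      solve 0 (con 1 :* con 1 :* con 1 :* con 1 := con 1) refl

    weight-node : ∀ c cs → weight (node (c ∷ cs)) ≈ firstChildFactor c * weight c * forestWeight cs
    weight-node c cs = begin
      monomial (b ℕ.+ o) (leavesF cs ℕ.+ (yleaf c ℕ.+ yleafF cs)) (b ℕ.+ i) (b′ ℕ.+ j)
        ≡⟨ ≡.cong (λ y → monomial (b ℕ.+ o) y (b ℕ.+ i) (b′ ℕ.+ j))
                  (swap (leavesF cs) (yleaf c) (yleafF cs)) ⟩
      monomial (b ℕ.+ o) (0 ℕ.+ y) (b ℕ.+ i) (b′ ℕ.+ j)
        ≈⟨ monomial-+ b 0 b b′ o y i j ⟩
      monomial b 0 b b′ * monomial o y i j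
        ≈⟨ *-cong (firstChildFactor-monomial c)
                  (monomial-+ (oleaf c) (yleaf c) (oint c) (yint c)
                              (oleafF cs) (leavesF cs ℕ.+ yleafF cs) (ointF cs) (yintF cs)) ⟩
      firstChildFactor c * (weight c * forestWeight cs)
        ≈⟨ *-assoc _ _ _ ⟨
      firstChildFactor c * weight c * forestWeight cs ∎
      where
      b  = b2n (isLeaf c)
      b′ = b2n (not (isLeaf c))
      o  = oleaf c ℕ.+ oleafF cs
      y  = yleaf c ℕ.+ (leavesF cs ℕ.+ yleafF cs)
      i  = oint c ℕ.+ ointF cs
      j  = yint c ℕ.+ yintF cs
      swap : ∀ l y z → l ℕ.+ (y ℕ.+ z) ≡ y ℕ.+ (l ℕ.+ z)
      swap = solve-∀

    forestWeight-cons : ∀ d ds → forestWeight (d ∷ ds) ≈ laterChildFactor d * weight d * forestWeight ds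
    forestWeight-cons d ds = begin
      monomial o ((b ℕ.+ leavesF ds) ℕ.+ (yleaf d ℕ.+ yleafF ds)) i j
        ≡⟨ ≡.cong (λ y → monomial o y i j) (regroup b (leavesF ds) (yleaf d) (yleafF ds)) ⟩
      monomial (0 ℕ.+ o) (b ℕ.+ y) (0 ℕ.+ i) (0 ℕ.+ j)
        ≈⟨ monomial-+ 0 b 0 0 o y i j ⟩
      monomial 0 b 0 0 * monomial o y i j
        ≈⟨ *-cong (laterChildFactor-monomial d)
                  (monomial-+ (oleaf d) (yleaf d) (oint d) (yint d)
                              (oleafF ds) (leavesF ds ℕ.+ yleafF ds) (ointF ds) (yintF ds)) ⟩
      laterChildFactor d * (weight d * forestWeight ds)
        ≈⟨ *-assoc _ _ _ ⟨
      laterChildFactor d * weight d * forestWeight ds ∎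
      where
      b = b2n (isLeaf d)
      o = oleaf d ℕ.+ oleafF ds
      y = yleaf d ℕ.+ (leavesF ds ℕ.+ yleafF ds)
      i = oint d ℕ.+ ointF ds
      j = yint d ℕ.+ yintF ds
      regroup : ∀ b l y z → (b ℕ.+ l) ℕ.+ (y ℕ.+ z) ≡ b ℕ.+ (y ℕ.+ (l ℕ.+ z))
      regroup = solve-∀

    u v : A
    u = x₁ * y₁
    v = x₂ + y₂

    G⁺ : Series
    G⁺ zero    = 0#
    G⁺ (suc n) = G R (suc n) x₁ x₂ y₁ y₂

    trees forests : Series
    trees   n = ∑[ cs ∈ forestsOf n ] weight (node cs)
    forests n = ∑[ cs ∈ forestsOf n ] forestWeight cs

    G≈trees : ∀ n → G R n x₁ x₂ y₁ y₂ ≈ trees n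
    G≈trees n = ∑-map node (forestsOf n) weight

    firstChildSum laterChildSum : Series
    firstChildSum j = ∑[ cs ∈ forestsOf j ] (firstChildFactor (node cs) * weight (node cs))
    laterChildSum j = ∑[ cs ∈ forestsOf j ] (laterChildFactor (node cs) * weight (node cs))

    trees-suc : ∀ n → trees (suc n) ≈ (firstChildSum ⋆ forests) n
    trees-suc n =
      ∑-forestsOf-suc-⋆ n (weight ∘ node) _ forestWeight λ cs ts → weight-node (node cs) ts

    forests-suc : ∀ n → forests (suc n) ≈ (laterChildSum ⋆ forests) n
    forests-suc n =
      ∑-forestsOf-suc-⋆ n forestWeight _ forestWeight λ cs ts → forestWeight-cons (node cs) ts

    firstChildSum≋ : firstChildSum ≋ λ j → u * δ j + y₂ * G⁺ j
    firstChildSum≋ zero    =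
      solve 2 (λ u y → u :* (con 1 :* con 1 :* con 1 :* con 1) :+ con 0 := u :* con 1 :+ y :* con 0)
              refl u y₂
    firstChildSum≋ (suc j) = begin
      firstChildSum (suc j)
        ≈⟨ ∑-forestsOf-suc-cong j (λ t ts → refl) ⟩
      ∑[ cs ∈ forestsOf (suc j) ] (y₂ * weight (node cs))
        ≈⟨ ∑-*ˡ y₂ (forestsOf (suc j)) (weight ∘ node) ⟨
      y₂ * trees (suc j)
        ≈⟨ *-cong refl (G≈trees (suc j)) ⟨
      y₂ * G⁺ (suc j)
        ≈⟨ trans (+-cong (zeroʳ u) refl) (+-identityˡ _) ⟨
      u * 0# + y₂ * G⁺ (suc j) ∎

    laterChildSum≋ : laterChildSum ≋ λ j → x₂ * δ j + G⁺ j
    laterChildSum≋ zero    =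
      solve 1 (λ x → x :* (con 1 :* con 1 :* con 1 :* con 1) :+ con 0 := x :* con 1 :+ con 0) refl x₂
    laterChildSum≋ (suc j) = begin
      laterChildSum (suc j)
        ≈⟨ ∑-forestsOf-suc-cong j (λ t ts → *-identityˡ _) ⟩
      trees (suc j)
        ≈⟨ G≈trees (suc j) ⟨
      G⁺ (suc j)
        ≈⟨ trans (+-cong (zeroʳ x₂) refl) (+-identityˡ _) ⟨
      x₂ * 0# + G⁺ (suc j) ∎

    G⁺≋shift : G⁺ ≋ shift ((λ j → u * δ j + y₂ * G⁺ j) ⋆ forests)
    G⁺≋shift zero    = refl
    G⁺≋shift (suc n) =
      trans (G≈trees (suc n)) (trans (trees-suc n) (⋆-cong {t = forests} firstChildSum≋ (λ _ → refl) n))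

    forests≋ : forests ≋ λ i → δ i + shift ((λ j → x₂ * δ j + G⁺ j) ⋆ forests) i
    forests≋ zero    = solve 0 (con 1 :* con 1 :* con 1 :* con 1 :+ con 0 := con 1 :+ con 0) refl
    forests≋ (suc n) =
      trans (forests-suc n) (trans (⋆-cong {t = forests} laterChildSum≋ (λ _ → refl) n)
                                   (sym (+-identityˡ _)))

    -- With H and K as below, forests = 1 + z K forests turns H forests into
    -- H + z K (H forests) = H + K G⁺.
    G⁺-recurrence : ∀ n → G⁺ (suc n) ≈ u * δ n + v * G⁺ n + (G⁺ ⋆ G⁺) n
    G⁺-recurrence n = begin
      G⁺ (suc n)
        ≈⟨ G⁺≋shift (suc n) ⟩
      (H ⋆ forests) n
        ≈⟨ ⋆-cong {s = H} (λ _ → refl) forests≋ n ⟩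
      (H ⋆ (λ i → δ i + shift (K ⋆ forests) i)) n
        ≈⟨ ⋆-comm H (λ i → δ i + shift (K ⋆ forests) i) n ⟩
      ((λ i → δ i + shift (K ⋆ forests) i) ⋆ H) n
        ≈⟨ ⋆-distribʳ δ (shift (K ⋆ forests)) H n ⟩
      (δ ⋆ H) n + (shift (K ⋆ forests) ⋆ H) n
        ≈⟨ +-cong (⋆-identityˡ H n) (⋆-shiftˡ (K ⋆ forests) H n) ⟩
      H n + shift (K ⋆ forests ⋆ H) n
        ≈⟨ +-cong refl (shift-cong (xy⋆z≋zy⋆x K forests H) n) ⟩
      H n + shift (H ⋆ forests ⋆ K) n
        ≈⟨ +-cong refl (trans (⋆-cong {t = K} G⁺≋shift (λ _ → refl) n)
                              (⋆-shiftˡ (H ⋆ forests) K n)) ⟨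
      H n + (G⁺ ⋆ K) n
        ≈⟨ +-cong refl (trans (⋆-comm G⁺ K n) (⋆-distribʳ (λ j → x₂ * δ j) G⁺ G⁺ n)) ⟩
      H n + (((λ j → x₂ * δ j) ⋆ G⁺) n + (G⁺ ⋆ G⁺) n)
        ≈⟨ +-cong refl (+-cong (trans (⋆-scaleˡ x₂ δ G⁺ n) (*-cong refl (⋆-identityˡ G⁺ n))) refl) ⟩
      u * δ n + y₂ * G⁺ n + (x₂ * G⁺ n + (G⁺ ⋆ G⁺) n)
        ≈⟨ solve 6 (λ u d y g x c → u :* d :+ y :* g :+ (x :* g :+ c) := u :* d :+ (x :+ y) :* g :+ c)
                   refl u (δ n) y₂ (G⁺ n) x₂ ((G⁺ ⋆ G⁺) n) ⟩
      u * δ n + v * G⁺ n + (G⁺ ⋆ G⁺) n ∎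
      where
      H K : Series
      H j = u * δ j + y₂ * G⁺ j
      K j = x₂ * δ j + G⁺ j

theorem1p12 : ∀ {c ℓ : Level} (R : CommutativeSemiring c ℓ) (n : ℕ)
              (x₁ x₂ y₁ y₂ : CommutativeSemiring.Carrier R) →
              CommutativeSemiring._≈_ R
                (G R (suc n) x₁ x₂ y₁ y₂)
                (M R n (CommutativeSemiring._*_ R x₁ y₁) (CommutativeSemiring._+_ R x₂ y₂))
theorem1p12 R n x₁ x₂ y₁ y₂ =
  motzkinRecurrence⇒M R u v G⁺ (CommutativeSemiring.refl R) G⁺-recurrence n
  where open PlaneTreeWeights R x₁ x₂ y₁ y₂
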